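{- In the lattice of subvarieties of the variety $\mathbb{SH}$ of semi-Heyting algebras: (1) $\mathbb{AT}1=\mathbb{AT}2$; (2) $\mathbb{BT}1\subsetneq\mathbb{BT}2\subsetneq\mathbb{AT}1$.
   Context: A semi-Heyting algebra is an algebra $\langle A;\wedge,\vee,\to,0,1\rangle$ such that $\langle A;\wedge,\vee,0,1\rangle$ is a bounded lattice and the identities $x\wedge(x\to y)\approx x\wedge y$, $x\wedge(y\to z)\approx x\wedge((x\wedge y)\to(x\wedge z))$, $x\to x\approx1$ hold; $\mathbb{SH}$ denotes their variety. Write $x^*:=x\to0$. $\mathbb{AT}1$, $\mathbb{AT}2$, $\mathbb{BT}1$, $\mathbb{BT}2$ are the subvarieties of $\mathbb{SH}$ defined respectively by the identities (AT1) $(x^*\to x)^*\approx1$, (AT2) $(x\to x^*)^*\approx1$, (BT1) $(x\to y)\to(x\to y^*)^*\approx1$, (BT2) $(x\to y^*)\to(x\to y)^*\approx1$. -}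

module Defs where

open import Level using (Level; suc)
open import Relation.Binary.PropositionalEquality using (_≡_)
open import Algebra.Core using (Op₂)
open import Algebra.Lattice.Structures using (IsLattice)

record SemiHeyting (ℓ : Level) : Set (suc ℓ) where
  infixr 5 _⇒_
  infixr 6 _∨_
  infixr 7 _∧_
  field
    Carrier   : Set ℓ
    _∧_       : Op₂ Carrier
    _∨_       : Op₂ Carrier
    _⇒_       : Op₂ Carrier
    𝟘         : Carrier
    𝟙         : Carrier
    isLattice : IsLattice _≡_ _∨_ _∧_
    𝟘-bottom  : ∀ x → 𝟘 ∧ x ≡ 𝟘
    𝟙-top     : ∀ x → 𝟙 ∧ x ≡ x
    SH1 : ∀ x y → x ∧ (x ⇒ y) ≡ x ∧ y
    SH2 : ∀ x y z → x ∧ (y ⇒ z) ≡ x ∧ ((x ∧ y) ⇒ (x ∧ z))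
    SH3 : ∀ x → x ⇒ x ≡ 𝟙

  _* : Carrier → Carrier
  x * = x ⇒ 𝟘
  infix 9 _*

module _ {ℓ : Level} (L : SemiHeyting ℓ) where
  open SemiHeyting L

  AT1 : Set ℓ
  AT1 = ∀ x → ((x *) ⇒ x) * ≡ 𝟙

  AT2 : Set ℓ
  AT2 = ∀ x → (x ⇒ (x *)) * ≡ 𝟙

  BT1 : Set ℓ
  BT1 = ∀ x y → (x ⇒ y) ⇒ ((x ⇒ (y *)) *) ≡ 𝟙

  BT2 : Set ℓ
  BT2 = ∀ x y → (x ⇒ (y *)) ⇒ ((x ⇒ y) *) ≡ 𝟙

-- Substituting 0 and 1 into each of AT1, AT2, BT1, BT2 yields 0 → 1 = 0. Conversely this
-- single identity implies AT1 and AT2: by SH2, w ∧ (y → z) only depends on w ∧ y and w ∧ z,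
-- so if w ∧ y = 0 and w ≤ z then w ∧ (y → z) = w ∧ (0 → 1) = 0; hence x* → x and x → x*
-- meet both x and x* trivially and must be 0. So AT1 = AT2 is the variety 0 → 1 ≈ 0, which
-- contains BT2. For BT1 ⊆ BT2, write a = x → y and c = x → y*: BT1 gives a ≤ c*, and with
-- 0 → 1 = 0 also c* ∧ a* = 0, so c** = a*; BT1 at x = 1 gives c → c** = 1. Both inclusions
-- are strict, witnessed by semi-Heyting chains of three and four elements.
module Submission where

open import Defs
open import Level using (Level; Lift; lift; lower)
open import Function using (_∘_; case_of_)
open import Data.Nat using (ℕ)
open import Data.Fin using (Fin; zero; suc; fromℕ)
open import Data.Fin.Patterns using (0F; 1F; 2F; 3F)
open import Data.Fin.Properties using (_≟_; all?)
open import Data.Product using (_×_; Σ; _,_)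
open import Relation.Nullary using (¬_; Dec; yes; no)
open import Relation.Nullary.Decidable using (_×-dec_; from-yes)
open import Relation.Binary.PropositionalEquality
  using (_≡_; refl; sym; trans; cong; cong₂; isEquivalence; module ≡-Reasoning)
open import Algebra.Core using (Op₂)
open import Algebra.Lattice.Bundles using (Lattice)
open import Algebra.Lattice.Structures using (IsLattice)
import Algebra.Lattice.Properties.Lattice as LatticeProperties
open import Relation.Binary.Lattice using (MeetSemilattice)

module SemiHeytingProperties {ℓ : Level} (L : SemiHeyting ℓ) where
  open SemiHeyting L
  open IsLattice isLattice using (∧-comm; ∧-assoc)
  open ≡-Reasoning

  lattice : Lattice ℓ ℓ
  lattice = record
    { Carrier = Carrier ; _≈_ = _≡_ ; _∨_ = _∨_ ; _∧_ = _∧_ ; isLattice = isLattice }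

  open MeetSemilattice (LatticeProperties.∧-orderTheoreticMeetSemilattice lattice)
    using (_≤_; antisym; x∧y≤x; x∧y≤y) renaming (refl to ≤-refl)

  ∧-identityʳ : ∀ x → x ∧ 𝟙 ≡ x
  ∧-identityʳ x = trans (∧-comm x 𝟙) (𝟙-top x)

  ∧-zeroʳ : ∀ x → x ∧ 𝟘 ≡ 𝟘
  ∧-zeroʳ x = trans (∧-comm x 𝟘) (𝟘-bottom x)

  ⇒-identityˡ : ∀ x → 𝟙 ⇒ x ≡ x
  ⇒-identityˡ x = trans (sym (𝟙-top (𝟙 ⇒ x))) (trans (SH1 𝟙 x) (𝟙-top x))

  x∧x*≡𝟘 : ∀ x → x ∧ x * ≡ 𝟘
  x∧x*≡𝟘 x = trans (SH1 x 𝟘) (∧-zeroʳ x)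

  x*∧x≡𝟘 : ∀ x → x * ∧ x ≡ 𝟘
  x*∧x≡𝟘 x = trans (∧-comm (x *) x) (x∧x*≡𝟘 x)

  ⇒≡𝟙⇒≤ : ∀ {x y} → x ⇒ y ≡ 𝟙 → x ≤ y
  ⇒≡𝟙⇒≤ {x} {y} x⇒y≡𝟙 = begin
    x             ≡⟨ ∧-identityʳ x ⟨
    x ∧ 𝟙         ≡⟨ cong (x ∧_) x⇒y≡𝟙 ⟨
    x ∧ (x ⇒ y)   ≡⟨ SH1 x y ⟩
    x ∧ y         ∎

  *≡𝟙⇒≡𝟘 : ∀ {x} → x * ≡ 𝟙 → x ≡ 𝟘
  *≡𝟙⇒≡𝟘 {x} x*≡𝟙 = trans (⇒≡𝟙⇒≤ x*≡𝟙) (∧-zeroʳ x)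

  disjoint⇒≤* : ∀ {x y} → y ∧ x ≡ 𝟘 → x ≤ y *
  disjoint⇒≤* {x} {y} y∧x≡𝟘 = sym (begin
    x ∧ (y ⇒ 𝟘)               ≡⟨ SH2 x y 𝟘 ⟩
    x ∧ ((x ∧ y) ⇒ (x ∧ 𝟘))   ≡⟨ cong₂ (λ u v → x ∧ (u ⇒ v)) (trans (∧-comm x y) y∧x≡𝟘) (∧-zeroʳ x) ⟩
    x ∧ (𝟘 ⇒ 𝟘)               ≡⟨ cong (x ∧_) (SH3 𝟘) ⟩
    x ∧ 𝟙                     ≡⟨ ∧-identityʳ x ⟩
    x                         ∎)

  ≤-disjoint : ∀ {x y z} → x ≤ y → y ∧ z ≡ 𝟘 → x ∧ z ≡ 𝟘
  ≤-disjoint {x} {y} {z} x≤y y∧z≡𝟘 = begin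
    x ∧ z          ≡⟨ cong (_∧ z) x≤y ⟩
    (x ∧ y) ∧ z    ≡⟨ ∧-assoc x y z ⟩
    x ∧ (y ∧ z)    ≡⟨ cong (x ∧_) y∧z≡𝟘 ⟩
    x ∧ 𝟘          ≡⟨ ∧-zeroʳ x ⟩
    𝟘              ∎

  disjoint-from-x-and-x*⇒≡𝟘 : ∀ {x y} → x ∧ y ≡ 𝟘 → y ∧ x * ≡ 𝟘 → y ≡ 𝟘
  disjoint-from-x-and-x*⇒≡𝟘 x∧y≡𝟘 y∧x*≡𝟘 = trans (disjoint⇒≤* x∧y≡𝟘) y∧x*≡𝟘

  AT : Set ℓ
  AT = 𝟘 ⇒ 𝟙 ≡ 𝟘

  AT⇒disjoint-⇒ : AT → ∀ {w y z} → w ∧ y ≡ 𝟘 → w ≤ z → w ∧ (y ⇒ z) ≡ 𝟘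
  AT⇒disjoint-⇒ at {w} {y} {z} w∧y≡𝟘 w≤z = begin
    w ∧ (y ⇒ z)               ≡⟨ SH2 w y z ⟩
    w ∧ ((w ∧ y) ⇒ (w ∧ z))   ≡⟨ cong₂ (λ u v → w ∧ (u ⇒ v)) w∧y≡w∧𝟘 w∧z≡w∧𝟙 ⟩
    w ∧ ((w ∧ 𝟘) ⇒ (w ∧ 𝟙))   ≡⟨ SH2 w 𝟘 𝟙 ⟨
    w ∧ (𝟘 ⇒ 𝟙)               ≡⟨ cong (w ∧_) at ⟩
    w ∧ 𝟘                     ≡⟨ ∧-zeroʳ w ⟩
    𝟘                         ∎
    where
    w∧y≡w∧𝟘 : w ∧ y ≡ w ∧ 𝟘
    w∧y≡w∧𝟘 = trans w∧y≡𝟘 (sym (∧-zeroʳ w))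
    w∧z≡w∧𝟙 : w ∧ z ≡ w ∧ 𝟙
    w∧z≡w∧𝟙 = trans (sym w≤z) (sym (∧-identityʳ w))

  AT⇒x*⇒x≡𝟘 : AT → ∀ x → x * ⇒ x ≡ 𝟘
  AT⇒x*⇒x≡𝟘 at x = disjoint-from-x-and-x*⇒≡𝟘 x∧[x*⇒x]≡𝟘 [x*⇒x]∧x*≡𝟘
    where
    x∧[x*⇒x]≡𝟘 : x ∧ (x * ⇒ x) ≡ 𝟘
    x∧[x*⇒x]≡𝟘 = AT⇒disjoint-⇒ at (x∧x*≡𝟘 x) ≤-refl
    [x*⇒x]∧x*≡𝟘 : (x * ⇒ x) ∧ x * ≡ 𝟘
    [x*⇒x]∧x*≡𝟘 = trans (∧-comm _ (x *)) (trans (SH1 (x *) x) (x*∧x≡𝟘 x))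

  AT⇒x⇒x*≡𝟘 : AT → ∀ x → x ⇒ x * ≡ 𝟘
  AT⇒x⇒x*≡𝟘 at x = disjoint-from-x-and-x*⇒≡𝟘 x∧[x⇒x*]≡𝟘 [x⇒x*]∧x*≡𝟘
    where
    x∧[x⇒x*]≡𝟘 : x ∧ (x ⇒ x *) ≡ 𝟘
    x∧[x⇒x*]≡𝟘 = trans (SH1 x (x *)) (x∧x*≡𝟘 x)
    [x⇒x*]∧x*≡𝟘 : (x ⇒ x *) ∧ x * ≡ 𝟘
    [x⇒x*]∧x*≡𝟘 = trans (∧-comm _ (x *)) (AT⇒disjoint-⇒ at (x*∧x≡𝟘 x) ≤-refl)

  AT⇒AT1 : AT → AT1 L
  AT⇒AT1 at x = trans (cong _* (AT⇒x*⇒x≡𝟘 at x)) (SH3 𝟘)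

  AT⇒AT2 : AT → AT2 L
  AT⇒AT2 at x = trans (cong _* (AT⇒x⇒x*≡𝟘 at x)) (SH3 𝟘)

  AT1⇒AT : AT1 L → AT
  AT1⇒AT at1 = *≡𝟙⇒≡𝟘 (begin
    (𝟘 ⇒ 𝟙) *        ≡⟨ cong (λ u → (u ⇒ 𝟙) *) (⇒-identityˡ 𝟘) ⟨
    ((𝟙 *) ⇒ 𝟙) *    ≡⟨ at1 𝟙 ⟩
    𝟙                ∎)

  AT2⇒AT : AT2 L → AT
  AT2⇒AT at2 = *≡𝟙⇒≡𝟘 (begin
    (𝟘 ⇒ 𝟙) *        ≡⟨ cong (λ u → (𝟘 ⇒ u) *) (SH3 𝟘) ⟨
    (𝟘 ⇒ (𝟘 *)) *    ≡⟨ at2 𝟘 ⟩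
    𝟙                ∎)

  BT1⇒AT : BT1 L → AT
  BT1⇒AT bt1 = *≡𝟙⇒≡𝟘 (begin
    (𝟘 ⇒ 𝟙) *                    ≡⟨ ⇒-identityˡ _ ⟨
    𝟙 ⇒ (𝟘 ⇒ 𝟙) *                ≡⟨ cong₂ (λ u v → u ⇒ (𝟘 ⇒ v) *) (SH3 𝟘) (SH3 𝟘) ⟨
    (𝟘 ⇒ 𝟘) ⇒ (𝟘 ⇒ (𝟘 *)) *      ≡⟨ bt1 𝟘 𝟘 ⟩
    𝟙                            ∎)

  BT2⇒AT : BT2 L → AT
  BT2⇒AT bt2 = *≡𝟙⇒≡𝟘 (begin
    (𝟘 ⇒ 𝟙) *                    ≡⟨ cong ((𝟘 ⇒ 𝟙) ⇒_) (⇒-identityˡ 𝟘) ⟨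
    (𝟘 ⇒ 𝟙) ⇒ 𝟙 *                ≡⟨ cong₂ (λ u v → (𝟘 ⇒ u) ⇒ v *) (SH3 𝟘) (SH3 𝟘) ⟨
    (𝟘 ⇒ (𝟘 *)) ⇒ (𝟘 ⇒ 𝟘) *      ≡⟨ bt2 𝟘 𝟘 ⟩
    𝟙                            ∎)

  BT1⇒x⇒x**≡𝟙 : BT1 L → ∀ x → x ⇒ x * * ≡ 𝟙
  BT1⇒x⇒x**≡𝟙 bt1 x = begin
    x ⇒ x * *                    ≡⟨ cong₂ (λ u v → u ⇒ v *) (⇒-identityˡ x) (⇒-identityˡ (x *)) ⟨
    (𝟙 ⇒ x) ⇒ (𝟙 ⇒ x *) *        ≡⟨ bt1 𝟙 x ⟩
    𝟙                            ∎

  BT1⇒BT2 : BT1 L → BT2 L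
  BT1⇒BT2 bt1 x y = begin
    c ⇒ a *        ≡⟨ cong (c ⇒_) c**≡a* ⟨
    c ⇒ c * *      ≡⟨ BT1⇒x⇒x**≡𝟙 bt1 c ⟩
    𝟙              ∎
    where
    a = x ⇒ y
    c = x ⇒ y *
    a≤c* : a ≤ c *
    a≤c* = ⇒≡𝟙⇒≤ (bt1 x y)
    c**≤a* : c * * ≤ a *
    c**≤a* = disjoint⇒≤* (≤-disjoint a≤c* (x∧x*≡𝟘 (c *)))
    c*∧a*≡𝟘 : c * ∧ a * ≡ 𝟘
    c*∧a*≡𝟘 = begin
      c * ∧ a *                ≡⟨ ∧-identityʳ _ ⟨
      (c * ∧ a *) ∧ 𝟙          ≡⟨ cong ((c * ∧ a *) ∧_) (bt1 x y) ⟨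
      (c * ∧ a *) ∧ (a ⇒ c *)  ≡⟨ AT⇒disjoint-⇒ (BT1⇒AT bt1) c*∧a*∧a≡𝟘 (x∧y≤x (c *) (a *)) ⟩
      𝟘                        ∎
      where
      c*∧a*∧a≡𝟘 : (c * ∧ a *) ∧ a ≡ 𝟘
      c*∧a*∧a≡𝟘 = ≤-disjoint (x∧y≤y (c *) (a *)) (x*∧x≡𝟘 a)
    a*≤c** : a * ≤ c * *
    a*≤c** = disjoint⇒≤* c*∧a*≡𝟘
    c**≡a* : c * * ≡ a *
    c**≡a* = antisym c**≤a* a*≤c**

open SemiHeytingProperties using (AT⇒AT1; AT⇒AT2; AT1⇒AT; AT2⇒AT; BT2⇒AT; BT1⇒BT2)

infixr 7 _⊓_
infixr 6 _⊔_

_⊓_ : ∀ {n} → Op₂ (Fin n)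
zero  ⊓ _     = zero
suc _ ⊓ zero  = zero
suc x ⊓ suc y = suc (x ⊓ y)

_⊔_ : ∀ {n} → Op₂ (Fin n)
zero  ⊔ y     = y
suc x ⊔ zero  = suc x
suc x ⊔ suc y = suc (x ⊔ y)

⊓-comm : ∀ {n} (x y : Fin n) → x ⊓ y ≡ y ⊓ x
⊓-comm zero    zero    = refl
⊓-comm zero    (suc _) = refl
⊓-comm (suc _) zero    = refl
⊓-comm (suc x) (suc y) = cong suc (⊓-comm x y)

⊓-assoc : ∀ {n} (x y z : Fin n) → (x ⊓ y) ⊓ z ≡ x ⊓ (y ⊓ z)
⊓-assoc zero    _       _       = refl
⊓-assoc (suc _) zero    _       = refl
⊓-assoc (suc _) (suc _) zero    = refl
⊓-assoc (suc x) (suc y) (suc z) = cong suc (⊓-assoc x y z)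

⊓-idem : ∀ {n} (x : Fin n) → x ⊓ x ≡ x
⊓-idem zero    = refl
⊓-idem (suc x) = cong suc (⊓-idem x)

⊓-identityˡ : ∀ n (x : Fin (ℕ.suc n)) → fromℕ n ⊓ x ≡ x
⊓-identityˡ ℕ.zero    zero    = refl
⊓-identityˡ (ℕ.suc _) zero    = refl
⊓-identityˡ (ℕ.suc n) (suc x) = cong suc (⊓-identityˡ n x)

⊔-comm : ∀ {n} (x y : Fin n) → x ⊔ y ≡ y ⊔ x
⊔-comm zero    zero    = refl
⊔-comm zero    (suc _) = refl
⊔-comm (suc _) zero    = refl
⊔-comm (suc x) (suc y) = cong suc (⊔-comm x y)

⊔-assoc : ∀ {n} (x y z : Fin n) → (x ⊔ y) ⊔ z ≡ x ⊔ (y ⊔ z)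
⊔-assoc zero    _       _       = refl
⊔-assoc (suc _) zero    _       = refl
⊔-assoc (suc _) (suc _) zero    = refl
⊔-assoc (suc x) (suc y) (suc z) = cong suc (⊔-assoc x y z)

⊔-absorbs-⊓ : ∀ {n} (x y : Fin n) → x ⊔ (x ⊓ y) ≡ x
⊔-absorbs-⊓ zero    _       = refl
⊔-absorbs-⊓ (suc _) zero    = refl
⊔-absorbs-⊓ (suc x) (suc y) = cong suc (⊔-absorbs-⊓ x y)

⊓-absorbs-⊔ : ∀ {n} (x y : Fin n) → x ⊓ (x ⊔ y) ≡ x
⊓-absorbs-⊔ zero    _       = refl
⊓-absorbs-⊔ (suc x) zero    = cong suc (⊓-idem x)
⊓-absorbs-⊔ (suc x) (suc y) = cong suc (⊓-absorbs-⊔ x y)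

module _ {n : ℕ} (_⇒_ : Op₂ (Fin (ℕ.suc n))) where

  IsSemiHeytingImplication : Set
  IsSemiHeytingImplication =
      (∀ x y → x ⊓ (x ⇒ y) ≡ x ⊓ y)
    × (∀ x y z → x ⊓ (y ⇒ z) ≡ x ⊓ ((x ⊓ y) ⇒ (x ⊓ z)))
    × (∀ x → x ⇒ x ≡ fromℕ n)

  isSemiHeytingImplication? : Dec IsSemiHeytingImplication
  isSemiHeytingImplication? =
        (all? λ x → all? λ y → x ⊓ (x ⇒ y) ≟ x ⊓ y)
    ×-dec (all? λ x → all? λ y → all? λ z → x ⊓ (y ⇒ z) ≟ x ⊓ ((x ⊓ y) ⇒ (x ⊓ z)))
    ×-dec (all? λ x → x ⇒ x ≟ fromℕ n)

chain : (ℓ : Level) {n : ℕ} (_⇒_ : Op₂ (Fin (ℕ.suc n))) → IsSemiHeytingImplication _⇒_ → SemiHeyting ℓ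
chain ℓ {n} _⇒_ (sh1 , sh2 , sh3) = record
  { Carrier   = Lift ℓ (Fin (ℕ.suc n))
  ; _∧_       = lift₂ _⊓_
  ; _∨_       = lift₂ _⊔_
  ; _⇒_       = lift₂ _⇒_
  ; 𝟘         = lift zero
  ; 𝟙         = lift (fromℕ n)
  ; isLattice = record
    { isEquivalence = isEquivalence
    ; ∨-comm        = λ x y → cong lift (⊔-comm (lower x) (lower y))
    ; ∨-assoc       = λ x y z → cong lift (⊔-assoc (lower x) (lower y) (lower z))
    ; ∨-cong        = cong₂ (lift₂ _⊔_)
    ; ∧-comm        = λ x y → cong lift (⊓-comm (lower x) (lower y))
    ; ∧-assoc       = λ x y z → cong lift (⊓-assoc (lower x) (lower y) (lower z))
    ; ∧-cong        = cong₂ (lift₂ _⊓_)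
    ; absorptive    = (λ x y → cong lift (⊔-absorbs-⊓ (lower x) (lower y)))
                    , (λ x y → cong lift (⊓-absorbs-⊔ (lower x) (lower y)))
    }
  ; 𝟘-bottom  = λ _ → refl
  ; 𝟙-top     = λ x → cong lift (⊓-identityˡ n (lower x))
  ; SH1       = λ x y → cong lift (sh1 (lower x) (lower y))
  ; SH2       = λ x y z → cong lift (sh2 (lower x) (lower y) (lower z))
  ; SH3       = λ x → cong lift (sh3 (lower x))
  }
  where
  lift₂ : Op₂ (Fin (ℕ.suc n)) → Op₂ (Lift ℓ (Fin (ℕ.suc n)))
  lift₂ f x y = lift (f (lower x) (lower y))

_⇔_ : ∀ {n} → Op₂ (Fin (ℕ.suc n))
_⇔_ {n} x y with x ≟ y
... | yes _ = fromℕ n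
... | no  _ = x ⊓ y

chain₃ : (ℓ : Level) → SemiHeyting ℓ
chain₃ ℓ = chain ℓ (_⇔_ {2}) (from-yes (isSemiHeytingImplication? (_⇔_ {2})))

chain₃-¬BT2 : (ℓ : Level) → ¬ BT2 (chain₃ ℓ)
chain₃-¬BT2 ℓ bt2 = case cong lower (bt2 (lift 1F) (lift 0F)) of λ ()

_⇒₄_ : Op₂ (Fin 4)
0F ⇒₄ 0F = 3F
0F ⇒₄ _  = 0F
1F ⇒₄ 0F = 0F
1F ⇒₄ 1F = 3F
1F ⇒₄ _  = 2F
2F ⇒₄ 0F = 0F
2F ⇒₄ 1F = 1F
2F ⇒₄ _  = 3F
3F ⇒₄ y  = y

chain₄ : (ℓ : Level) → SemiHeyting ℓ
chain₄ ℓ = chain ℓ _⇒₄_ (from-yes (isSemiHeytingImplication? _⇒₄_))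

chain₄-BT2 : (ℓ : Level) → BT2 (chain₄ ℓ)
chain₄-BT2 ℓ x y = cong lift (bt2 (lower x) (lower y))
  where
  bt2 : ∀ x y → (x ⇒₄ (y ⇒₄ 0F)) ⇒₄ ((x ⇒₄ y) ⇒₄ 0F) ≡ 3F
  bt2 = from-yes (all? λ x → all? λ y → (x ⇒₄ (y ⇒₄ 0F)) ⇒₄ ((x ⇒₄ y) ⇒₄ 0F) ≟ 3F)

chain₄-¬BT1 : (ℓ : Level) → ¬ BT1 (chain₄ ℓ)
chain₄-¬BT1 ℓ bt1 = case cong lower (bt1 (lift 2F) (lift 1F)) of λ ()

theorem5p11 : (ℓ : Level) →
    -- (1) AT1 = AT2
    ((L : SemiHeyting ℓ) → (AT1 L → AT2 L) × (AT2 L → AT1 L))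
    -- (2) BT1 ⊊ BT2
    × ((L : SemiHeyting ℓ) → BT1 L → BT2 L)
    × Σ (SemiHeyting ℓ) (λ L → BT2 L × ¬ BT1 L)
    -- (2) BT2 ⊊ AT1
    × ((L : SemiHeyting ℓ) → BT2 L → AT1 L)
    × Σ (SemiHeyting ℓ) (λ L → AT1 L × ¬ BT2 L)
theorem5p11 ℓ =
    (λ L → AT⇒AT2 L ∘ AT1⇒AT L , AT⇒AT1 L ∘ AT2⇒AT L)
  , BT1⇒BT2
  , (chain₄ ℓ , chain₄-BT2 ℓ , chain₄-¬BT1 ℓ)
  , (λ L → AT⇒AT1 L ∘ BT2⇒AT L)
  , (chain₃ ℓ , AT⇒AT1 (chain₃ ℓ) refl , chain₃-¬BT2 ℓ)
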